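{- In the one-shuffle model with $n\ge1$ cards and $h=\lceil n/2\rceil$, let $F_n(q)=\sum q^{X}$, the sum running over all $2^n$ outcomes. Then $$F_n(q)=\sum_{a=0}^{h}\sum_{b=0}^{n-h} G\bigl(a,\,h-a,\,a+(n-h-b)+1,\,q\bigr)\cdot G\bigl(b,\,n-h-b,\,b+(h-a)+1,\,q\bigr).$$
   Context: One-shuffle model. Fix an integer $n\ge 1$ (cards labelled $1,\dots,n$, initially in increasing order). An outcome of one riffle shuffle is a pair $(t,S)$ with $t\in\{0,\dots,n\}$ and $S\subseteq\{1,\dots,n\}$, $|S|=t$: the deck is cut into the first pile $A=(1,\dots,t)$ and second pile $B=(t+1,\dots,n)$, and the resulting permutation $\pi$ has the elements of $A$ in increasing order at the positions in $S$ and those of $B$ in increasing order at the other positions. There are $2^n$ outcomes, regarded as distinct even when they give the same permutation. Let $h=\lceil n/2\rceil$. The strategy $\mathcal G^*$ guesses $g(i)=\lfloor i/2\rfloor+1$ at position $i\le h$ and $g(j)=n-\lfloor (n+1-j)/2\rfloor$ at position $j\ge h+1$. $X$ is the number of positions $p$ with $\pi(p)=g(p)$. For integers $a_1,a_2\ge0$, $s\ge1$, $G(a_1,a_2,s,q)=\sum_w q^{c(w)}$, where $w$ ranges over the $\binom{a_1+a_2}{a_1}$ interleavings (order-preserving merges, distinguished by the positions of the first sequence) of $(1,\dots,a_1)$ and $(s,\dots,s+a_2-1)$, and $c(w)$ is the number of $i\in\{1,\dots,a_1+a_2\}$ with $w_i=\lfloor i/2\rfloor+1$. -}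

module Defs where

open import Data.Nat using (ℕ; zero; suc; _+_; _∸_; _^_; _≡ᵇ_; _≟_; ⌊_/2⌋; ⌈_/2⌉)
open import Data.Bool using (Bool; true; false; if_then_else_)
open import Data.List using (List; []; _∷_; map; _++_; filter; upTo)
open import Data.Nat.ListAction using (sum)

-- All words of length n over Bool.  A word w encodes a set S of positions
-- {1..n}: position i (1-indexed) lies in S iff the i-th letter is true.
allWords : ℕ → List (List Bool)
allWords zero    = [] ∷ []
allWords (suc n) = map (true ∷_) (allWords n) ++ map (false ∷_) (allWords n)

trues : List Bool → ℕ
trues []          = 0
trues (true ∷ w)  = suc (trues w)
trues (false ∷ w) = trues w

-- Merge of two increasing runs (u, u+1, ...) and (v, v+1, ...), where the
-- first run occupies the positions marked true.  `matches g i u v w` counts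
-- the positions p (starting at position i) whose merged value equals g p.
matches : (ℕ → ℕ) → ℕ → ℕ → ℕ → List Bool → ℕ
matches g i u v []          = 0
matches g i u v (true ∷ w)  = (if u ≡ᵇ g i then 1 else 0) + matches g (suc i) (suc u) v w
matches g i u v (false ∷ w) = (if v ≡ᵇ g i then 1 else 0) + matches g (suc i) u (suc v) w

half : ℕ → ℕ
half n = ⌈ n /2⌉

guess : ℕ → ℕ → ℕ
guess n p with p Data.Nat.≤ᵇ half n
... | true  = ⌊ p /2⌋ + 1
... | false = n ∸ ⌊ (n + 1 ∸ p) /2⌋

-- Outcome (t,S) of a riffle shuffle, t = |S| determined by S, encoded by the
-- word S of length n.  The permutation places 1..t at positions in S and
-- t+1..n at the others; X counts p with π(p) = guess n p.
X : ℕ → List Bool → ℕ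
X n S = matches (guess n) 1 1 (suc (trues S)) S

F : ℕ → ℕ → ℕ
F n q = sum (map (λ S → q ^ X n S) (allWords n))

-- interleavings of (1..a₁) and (s..s+a₂-1): words of length a₁+a₂ with
-- exactly a₁ letters true (positions of the first sequence)
interleavings : ℕ → ℕ → List (List Bool)
interleavings a₁ a₂ = filter (λ w → trues w ≟ a₁) (allWords (a₁ + a₂))

c : ℕ → List Bool → ℕ
c s w = matches (λ i → ⌊ i /2⌋ + 1) 1 1 s w

G : ℕ → ℕ → ℕ → ℕ → ℕ
G a₁ a₂ s q = sum (map (λ w → q ^ c s w) (interleavings a₁ a₂))

Σ[0…_]_ : ℕ → (ℕ → ℕ) → ℕ
Σ[0… m ] f = sum (map f (upTo (suc m)))

-- Cut an outcome after position h.  On the first h positions G* guesses ⌊i/2⌋ + 1, so that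
-- part is scored exactly like an interleaving by c.  G* is symmetric under the point
-- reflection of the deck (position p ↦ n+1−p, card x ↦ n+1−x), which turns the last n − h
-- positions, read backwards with the piles exchanged, into an interleaving scored by c as
-- well.  The halves interact only through the starting values of the runs, which depend
-- only on the numbers a, b of first-pile cards in each half; grouping outcomes by (a, b)
-- gives the sum of products.
module Submission where

open import Defs
open import Data.Bool using (Bool; true; false; not; if_then_else_)
open import Data.List using (List; []; _∷_; _++_; _∷ʳ_; map; filter; length; upTo)
open import Data.List.Properties using (map-++; map-∘; map-cong; map-cong-local; map-applyUpTo; length-++)
open import Data.List.Relation.Unary.All as All using (All; []; _∷_)
open import Data.List.Relation.Unary.All.Properties using (++⁺; map⁺; applyUpTo⁺₁)
open import Data.Nat
open import Data.Nat.ListAction using (sum)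
open import Data.Nat.ListAction.Properties using (sum-++)
open import Data.Nat.Properties
open import Algebra.Properties.CommutativeSemigroup +-commutativeSemigroup using (interchange)
open import Data.Nat.Tactic.RingSolver using (solve-∀)
open import Function using (_∘_; id)
open import Relation.Nullary using (Dec; does; yes; no; contradiction)
open import Relation.Nullary.Decidable using (dec-true; dec-false)
open import Relation.Nullary.Reflects using (ofʸ; ofⁿ)
open import Relation.Binary.PropositionalEquality
open ≡-Reasoning

private
  variable
    A B : Set

sum-map-cong : {f g : A → ℕ} → (∀ x → f x ≡ g x) → (xs : List A) → sum (map f xs) ≡ sum (map g xs)
sum-map-cong f≗g xs = cong sum (map-cong f≗g xs)

sum-map-++ : (f : A → ℕ) (xs ys : List A) → sum (map f (xs ++ ys)) ≡ sum (map f xs) + sum (map f ys)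
sum-map-++ f xs ys = trans (cong sum (map-++ f xs ys)) (sum-++ (map f xs) (map f ys))

sum-map-0 : (xs : List A) → sum (map (λ _ → 0) xs) ≡ 0
sum-map-0 []       = refl
sum-map-0 (_ ∷ xs) = sum-map-0 xs

sum-map-+ : (f g : A → ℕ) (xs : List A) → sum (map (λ x → f x + g x) xs) ≡ sum (map f xs) + sum (map g xs)
sum-map-+ f g []       = refl
sum-map-+ f g (x ∷ xs) = trans (cong (f x + g x +_) (sum-map-+ f g xs)) (interchange (f x) (g x) _ _)

*-sum-map : ∀ k (f : A → ℕ) (xs : List A) → k * sum (map f xs) ≡ sum (map (λ x → k * f x) xs)
*-sum-map k f []       = *-zeroʳ k
*-sum-map k f (x ∷ xs) = trans (*-distribˡ-+ k (f x) _) (cong (k * f x +_) (*-sum-map k f xs))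

sum-map-* : (f : A → ℕ) (g : B → ℕ) (xs : List A) (ys : List B) →
  sum (map f xs) * sum (map g ys) ≡ sum (map (λ x → sum (map (λ y → f x * g y) ys)) xs)
sum-map-* f g []       ys = refl
sum-map-* f g (x ∷ xs) ys = begin
  (f x + sum (map f xs)) * sum (map g ys)                 ≡⟨ *-distribʳ-+ (sum (map g ys)) (f x) _ ⟩
  f x * sum (map g ys) + sum (map f xs) * sum (map g ys)  ≡⟨ cong₂ _+_ (*-sum-map (f x) g ys) (sum-map-* f g xs ys) ⟩
  sum (map (λ y → f x * g y) ys) + _                      ∎

sum-map-swap : (F : A → B → ℕ) (xs : List A) (ys : List B) →
  sum (map (λ x → sum (map (F x) ys)) xs) ≡ sum (map (λ y → sum (map (λ x → F x y) xs)) ys)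
sum-map-swap F []       ys = sym (sum-map-0 ys)
sum-map-swap F (x ∷ xs) ys =
  trans (cong (sum (map (F x) ys) +_) (sum-map-swap F xs ys))
        (sym (sum-map-+ (F x) (λ y → sum (map (λ x → F x y) xs)) ys))

sum-map-filter-∷ : ∀ {P : A → Set} (P? : ∀ x → Dec (P x)) (f : A → ℕ) x xs →
  sum (map f (filter P? (x ∷ xs))) ≡ (if does (P? x) then f x else 0) + sum (map f (filter P? xs))
sum-map-filter-∷ P? f x xs with does (P? x)
... | true  = refl
... | false = refl

Σ-suc : ∀ k (f : ℕ → ℕ) → Σ[0… suc k ] f ≡ f 0 + Σ[0… k ] (f ∘ suc)
Σ-suc k f = cong (λ xs → f 0 + sum xs)
  (trans (map-applyUpTo suc f (suc k)) (sym (map-applyUpTo id (f ∘ suc) (suc k))))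

Σ-cong : ∀ k {f g : ℕ → ℕ} → (∀ {a} → a ≤ k → f a ≡ g a) → Σ[0… k ] f ≡ Σ[0… k ] g
Σ-cong k f≗g = cong sum (map-cong-local (applyUpTo⁺₁ id (suc k) (f≗g ∘ ≤-pred)))

Σ-indicator : ∀ k j (f : ℕ → ℕ) → j ≤ k → Σ[0… k ] (λ a → if does (j ≟ a) then f a else 0) ≡ f j
Σ-indicator zero    zero    f z≤n       = +-identityʳ (f 0)
Σ-indicator (suc k) zero    f z≤n       =
  trans (Σ-suc k (λ a → if does (0 ≟ a) then f a else 0))
        (trans (cong (f 0 +_) (sum-map-0 (upTo (suc k)))) (+-identityʳ (f 0)))
Σ-indicator (suc k) (suc j) f (s≤s j≤k) =
  trans (Σ-suc k (λ a → if does (suc j ≟ a) then f a else 0)) (Σ-indicator k j (f ∘ suc) j≤k)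

Σ-fibres : ∀ k (t : A → ℕ) (f : ℕ → A → ℕ) {xs} → All (λ x → t x ≤ k) xs →
  Σ[0… k ] (λ a → sum (map (f a) (filter (λ x → t x ≟ a) xs))) ≡ sum (map (λ x → f (t x) x) xs)
Σ-fibres k t f []                     = sum-map-0 (upTo (suc k))
Σ-fibres k t f {x ∷ xs} (tx≤k ∷ t≤k) = begin
  Σ[0… k ] (λ a → sum (map (f a) (filter (λ y → t y ≟ a) (x ∷ xs))))
    ≡⟨ sum-map-cong (λ a → sum-map-filter-∷ (λ y → t y ≟ a) (f a) x xs) (upTo (suc k)) ⟩
  Σ[0… k ] (λ a → (if does (t x ≟ a) then f a x else 0) + sum (map (f a) (filter (λ y → t y ≟ a) xs)))
    ≡⟨ sum-map-+ (λ a → if does (t x ≟ a) then f a x else 0)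
                 (λ a → sum (map (f a) (filter (λ y → t y ≟ a) xs))) (upTo (suc k)) ⟩
  Σ[0… k ] (λ a → if does (t x ≟ a) then f a x else 0)
    + Σ[0… k ] (λ a → sum (map (f a) (filter (λ y → t y ≟ a) xs)))
    ≡⟨ cong₂ _+_ (Σ-indicator k (t x) (λ a → f a x) tx≤k) (Σ-fibres k t f t≤k) ⟩
  f (t x) x + sum (map (λ y → f (t y) y) xs)
    ∎

sumWords : ℕ → (List Bool → ℕ) → ℕ
sumWords m f = sum (map f (allWords m))

sumWordsWithTrues : ℕ → ℕ → (List Bool → ℕ) → ℕ
sumWordsWithTrues m a f = sum (map f (filter (λ w → trues w ≟ a) (allWords m)))

allWords-length : ∀ m → All (λ w → length w ≡ m) (allWords m)
allWords-length zero    = refl ∷ []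
allWords-length (suc m) = ++⁺ (map⁺ (All.map (cong suc) (allWords-length m)))
                              (map⁺ (All.map (cong suc) (allWords-length m)))

trues≤length : ∀ w → trues w ≤ length w
trues≤length []          = z≤n
trues≤length (true ∷ w)  = s≤s (trues≤length w)
trues≤length (false ∷ w) = m≤n⇒m≤1+n (trues≤length w)

allWords-trues≤ : ∀ m → All (λ w → trues w ≤ m) (allWords m)
allWords-trues≤ m = All.map (λ {w} len → subst (trues w ≤_) len (trues≤length w)) (allWords-length m)

sumWords-cong : ∀ m {f g : List Bool → ℕ} → (∀ w → length w ≡ m → f w ≡ g w) → sumWords m f ≡ sumWords m g
sumWords-cong m f≗g = cong sum (map-cong-local (All.map (λ {w} → f≗g w) (allWords-length m)))

sumWords-suc : ∀ m f → sumWords (suc m) f ≡ sumWords m (f ∘ (true ∷_)) + sumWords m (f ∘ (false ∷_))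
sumWords-suc m f = begin
  sum (map f (map (true ∷_) W ++ map (false ∷_) W))        ≡⟨ sum-map-++ f (map (true ∷_) W) (map (false ∷_) W) ⟩
  sum (map f (map (true ∷_) W)) + sum (map f (map (false ∷_) W))
    ≡⟨ cong₂ _+_ (cong sum (map-∘ W)) (cong sum (map-∘ W)) ⟨
  sumWords m (f ∘ (true ∷_)) + sumWords m (f ∘ (false ∷_)) ∎
  where W = allWords m

sumWords-split : ∀ h m f → sumWords (h + m) f ≡ sumWords h (λ u → sumWords m (λ v → f (u ++ v)))
sumWords-split zero    m f = sym (+-identityʳ (sumWords m f))
sumWords-split (suc h) m f = begin
  sumWords (suc h + m) f
    ≡⟨ sumWords-suc (h + m) f ⟩
  sumWords (h + m) (f ∘ (true ∷_)) + sumWords (h + m) (f ∘ (false ∷_))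
    ≡⟨ cong₂ _+_ (sumWords-split h m (f ∘ (true ∷_))) (sumWords-split h m (f ∘ (false ∷_))) ⟩
  sumWords h (λ u → sumWords m (λ v → f (true ∷ u ++ v)))
    + sumWords h (λ u → sumWords m (λ v → f (false ∷ u ++ v)))
    ≡⟨ sumWords-suc h (λ u → sumWords m (λ v → f (u ++ v))) ⟨
  sumWords (suc h) (λ u → sumWords m (λ v → f (u ++ v))) ∎

sumWords-∷ʳ : ∀ m f → sumWords (suc m) f ≡ sumWords m (f ∘ (_∷ʳ true)) + sumWords m (f ∘ (_∷ʳ false))
sumWords-∷ʳ zero    f = cong (_+ (f (false ∷ []) + 0)) (sym (+-identityʳ (f (true ∷ []))))
sumWords-∷ʳ (suc m) f = begin
  sumWords (suc (suc m)) f
    ≡⟨ sumWords-suc (suc m) f ⟩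
  sumWords (suc m) (f ∘ (true ∷_)) + sumWords (suc m) (f ∘ (false ∷_))
    ≡⟨ cong₂ _+_ (sumWords-∷ʳ m (f ∘ (true ∷_))) (sumWords-∷ʳ m (f ∘ (false ∷_))) ⟩
  (S true true + S true false) + (S false true + S false false)
    ≡⟨ interchange (S true true) (S true false) (S false true) (S false false) ⟩
  (S true true + S false true) + (S true false + S false false)
    ≡⟨ cong₂ _+_ (sumWords-suc m (f ∘ (_∷ʳ true))) (sumWords-suc m (f ∘ (_∷ʳ false))) ⟨
  sumWords (suc m) (f ∘ (_∷ʳ true)) + sumWords (suc m) (f ∘ (_∷ʳ false)) ∎
  where
  S : Bool → Bool → ℕ
  S first last = sumWords m (λ w → f ((first ∷ w) ∷ʳ last))

mirror : List Bool → List Bool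
mirror []      = []
mirror (b ∷ w) = mirror w ∷ʳ not b

sumWords-mirror : ∀ m f → sumWords m (f ∘ mirror) ≡ sumWords m f
sumWords-mirror zero    f = refl
sumWords-mirror (suc m) f = begin
  sumWords (suc m) (f ∘ mirror)
    ≡⟨ sumWords-suc m (f ∘ mirror) ⟩
  sumWords m (λ w → f (mirror w ∷ʳ false)) + sumWords m (λ w → f (mirror w ∷ʳ true))
    ≡⟨ cong₂ _+_ (sumWords-mirror m (f ∘ (_∷ʳ false))) (sumWords-mirror m (f ∘ (_∷ʳ true))) ⟩
  sumWords m (f ∘ (_∷ʳ false)) + sumWords m (f ∘ (_∷ʳ true))
    ≡⟨ +-comm (sumWords m (f ∘ (_∷ʳ false))) _ ⟩
  sumWords m (f ∘ (_∷ʳ true)) + sumWords m (f ∘ (_∷ʳ false))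
    ≡⟨ sumWords-∷ʳ m f ⟨
  sumWords (suc m) f
    ∎

falses : List Bool → ℕ
falses []          = 0
falses (true ∷ w)  = falses w
falses (false ∷ w) = suc (falses w)

trues+falses≡length : ∀ w → trues w + falses w ≡ length w
trues+falses≡length []          = refl
trues+falses≡length (true ∷ w)  = cong suc (trues+falses≡length w)
trues+falses≡length (false ∷ w) = trans (+-suc (trues w) (falses w)) (cong suc (trues+falses≡length w))

falses≡length∸trues : ∀ w → falses w ≡ length w ∸ trues w
falses≡length∸trues w = trans (sym (m+n∸m≡n (trues w) (falses w))) (cong (_∸ trues w) (trues+falses≡length w))

trues-++ : ∀ u v → trues (u ++ v) ≡ trues u + trues v
trues-++ []          v = refl
trues-++ (true ∷ u)  v = cong suc (trues-++ u v)
trues-++ (false ∷ u) v = trues-++ u v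

falses-++ : ∀ u v → falses (u ++ v) ≡ falses u + falses v
falses-++ []          v = refl
falses-++ (true ∷ u)  v = falses-++ u v
falses-++ (false ∷ u) v = cong suc (falses-++ u v)

length-mirror : ∀ w → length (mirror w) ≡ length w
length-mirror []      = refl
length-mirror (b ∷ w) = trans (length-++ (mirror w)) (trans (+-comm _ 1) (cong suc (length-mirror w)))

trues-mirror : ∀ w → trues (mirror w) ≡ falses w
trues-mirror []          = refl
trues-mirror (true ∷ w)  = trans (trues-++ (mirror w) (false ∷ [])) (trans (+-identityʳ _) (trues-mirror w))
trues-mirror (false ∷ w) = trans (trues-++ (mirror w) (true ∷ [])) (trans (+-comm _ 1) (cong suc (trues-mirror w)))

falses-mirror : ∀ w → falses (mirror w) ≡ trues w
falses-mirror []          = refl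
falses-mirror (true ∷ w)  = trans (falses-++ (mirror w) (false ∷ [])) (trans (+-comm _ 1) (cong suc (falses-mirror w)))
falses-mirror (false ∷ w) = trans (falses-++ (mirror w) (true ∷ [])) (trans (+-identityʳ _) (falses-mirror w))

matches-++ : ∀ g i u v w₁ w₂ → matches g i u v (w₁ ++ w₂) ≡
  matches g i u v w₁ + matches g (i + length w₁) (u + trues w₁) (v + falses w₁) w₂
matches-++ g i u v [] w₂ rewrite +-identityʳ i | +-identityʳ u | +-identityʳ v = refl
matches-++ g i u v (true ∷ w₁) w₂
  rewrite matches-++ g (suc i) (suc u) v w₁ w₂ | +-suc i (length w₁) | +-suc u (trues w₁) =
  sym (+-assoc (if u ≡ᵇ g i then 1 else 0) _ _)
matches-++ g i u v (false ∷ w₁) w₂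
  rewrite matches-++ g (suc i) u (suc v) w₁ w₂ | +-suc i (length w₁) | +-suc v (falses w₁) =
  sym (+-assoc (if v ≡ᵇ g i then 1 else 0) _ _)

private
  first-position : ∀ {P : ℕ → Set} i L → (∀ {p} → i ≤ p → p < i + suc L → P p) → P i
  first-position i L P = P ≤-refl (subst (i <_) (sym (+-suc i L)) (s≤s (m≤m+n i L)))

  later-positions : ∀ {P : ℕ → Set} i L → (∀ {p} → i ≤ p → p < i + suc L → P p) →
    ∀ {p} → suc i ≤ p → p < suc i + L → P p
  later-positions i L P {p} i<p p<i+L = P (<⇒≤ i<p) (subst (p <_) (sym (+-suc i L)) p<i+L)

matches-cong : ∀ {g g'} i u v w → (∀ {p} → i ≤ p → p < i + length w → g p ≡ g' p) →
  matches g i u v w ≡ matches g' i u v w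
matches-cong i u v []          g≗g' = refl
matches-cong i u v (true ∷ w)  g≗g' =
  cong₂ _+_ (cong (λ x → if u ≡ᵇ x then 1 else 0) (first-position i (length w) g≗g'))
            (matches-cong (suc i) (suc u) v w (later-positions i (length w) g≗g'))
matches-cong i u v (false ∷ w) g≗g' =
  cong₂ _+_ (cong (λ x → if v ≡ᵇ x then 1 else 0) (first-position i (length w) g≗g'))
            (matches-cong (suc i) u (suc v) w (later-positions i (length w) g≗g'))

≡ᵇ-cong-⇔ : ∀ m n k l → (m ≡ n → k ≡ l) → (k ≡ l → m ≡ n) → (m ≡ᵇ n) ≡ (k ≡ᵇ l)
≡ᵇ-cong-⇔ m n k l to from with m ≟ n
... | yes m≡n = trans (dec-true (m ≟ n) m≡n) (sym (dec-true (k ≟ l) (to m≡n)))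
... | no m≢n  = trans (dec-false (m ≟ n) m≢n) (sym (dec-false (k ≟ l) (m≢n ∘ from)))

≡ᵇ-reflect : ∀ {C} x x' y y' → x + x' ≡ C → y + y' ≡ C → (x ≡ᵇ y) ≡ (x' ≡ᵇ y')
≡ᵇ-reflect x x' y y' x+x' y+y' = ≡ᵇ-cong-⇔ x y x' y'
  (λ { refl → +-cancelˡ-≡ x x' y' (trans x+x' (sym y+y')) })
  (λ { refl → +-cancelʳ-≡ x' x y (trans x+x' (sym y+y')) })

private
  suc-middle-injective : ∀ a b c {d} → a + suc b + c ≡ suc d → a + b + c ≡ d
  suc-middle-injective a b c eq = suc-injective (trans (cong (_+ c) (sym (+-suc a b))) eq)

  suc-middle≡suc-last : ∀ a b c → a + suc b + c ≡ a + b + suc c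
  suc-middle≡suc-last = solve-∀

  move-suc-last : ∀ {a b c d} → a + suc b + c ≡ d → a + b + suc c ≡ d
  move-suc-last {a} {b} {c} = trans (sym (suc-middle≡suc-last a b c))

  m+[n+0]≡n+m : ∀ m x → m + (x + 0) ≡ x + m
  m+[n+0]≡n+m m x = trans (cong (m +_) (+-identityʳ x)) (+-comm m x)

-- The point reflection p ↦ C − p, y ↦ C − y of the (position, value) plane carries
-- the merge coded by mirror w onto the one coded by w, and g onto g'.
matches-mirror : ∀ {C} g g' → (∀ p p' → p + p' ≡ C → g p + g' p' ≡ C) →
  ∀ w {i j u v u' v'} → i + length w + j ≡ suc C → u + falses w + v' ≡ suc C → v + trues w + u' ≡ suc C →
  matches g i u v (mirror w) ≡ matches g' j u' v' w
matches-mirror g g' reflect []          _   _  _  = refl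
matches-mirror g g' reflect (true ∷ w)  {i} {j} {u} {v} {u'} {v'} pos us vs = begin
  matches g i u v (mirror w ++ false ∷ [])
    ≡⟨ matches-++ g i u v (mirror w) (false ∷ []) ⟩
  matches g i u v (mirror w) + ((if v + falses (mirror w) ≡ᵇ g (i + length (mirror w)) then 1 else 0) + 0)
    ≡⟨ cong₂ (λ r b → r + ((if b then 1 else 0) + 0))
             (matches-mirror g g' reflect w (move-suc-last pos) us (move-suc-last vs))
             (≡ᵇ-reflect _ u' _ (g' j) value (reflect _ j position)) ⟩
  matches g' (suc j) (suc u') v' w + ((if u' ≡ᵇ g' j then 1 else 0) + 0)
    ≡⟨ m+[n+0]≡n+m (matches g' (suc j) (suc u') v' w) (if u' ≡ᵇ g' j then 1 else 0) ⟩
  matches g' j u' v' (true ∷ w) ∎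
  where
  position : i + length (mirror w) + j ≡ _
  position = trans (cong (λ L → i + L + j) (length-mirror w)) (suc-middle-injective i (length w) j pos)
  value : v + falses (mirror w) + u' ≡ _
  value = trans (cong (λ t → v + t + u') (falses-mirror w)) (suc-middle-injective v (trues w) u' vs)
matches-mirror g g' reflect (false ∷ w) {i} {j} {u} {v} {u'} {v'} pos us vs = begin
  matches g i u v (mirror w ++ true ∷ [])
    ≡⟨ matches-++ g i u v (mirror w) (true ∷ []) ⟩
  matches g i u v (mirror w) + ((if u + trues (mirror w) ≡ᵇ g (i + length (mirror w)) then 1 else 0) + 0)
    ≡⟨ cong₂ (λ r b → r + ((if b then 1 else 0) + 0))
             (matches-mirror g g' reflect w (move-suc-last pos) (move-suc-last us) vs)
             (≡ᵇ-reflect _ v' _ (g' j) value (reflect _ j position)) ⟩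
  matches g' (suc j) u' (suc v') w + ((if v' ≡ᵇ g' j then 1 else 0) + 0)
    ≡⟨ m+[n+0]≡n+m (matches g' (suc j) u' (suc v') w) (if v' ≡ᵇ g' j then 1 else 0) ⟩
  matches g' j u' v' (false ∷ w) ∎
  where
  position : i + length (mirror w) + j ≡ _
  position = trans (cong (λ L → i + L + j) (length-mirror w)) (suc-middle-injective i (length w) j pos)
  value : u + trues (mirror w) + v' ≡ _
  value = trans (cong (λ t → u + t + v') (trues-mirror w)) (suc-middle-injective u (falses w) v' us)

guessˡ : ℕ → ℕ
guessˡ p = ⌊ p /2⌋ + 1

guessʳ : ℕ → ℕ → ℕ
guessʳ n p = n ∸ ⌊ (n + 1 ∸ p) /2⌋

guess-≤-half : ∀ n {p} → p ≤ half n → guess n p ≡ guessˡ p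
guess-≤-half n {p} p≤h with p ≤ᵇ half n | ≤ᵇ-reflects-≤ p (half n)
... | true  | _       = refl
... | false | ofⁿ p≰h = contradiction p≤h p≰h

guess->-half : ∀ n {p} → half n < p → guess n p ≡ guessʳ n p
guess->-half n {p} h<p with p ≤ᵇ half n | ≤ᵇ-reflects-≤ p (half n)
... | false | _       = refl
... | true  | ofʸ p≤h = contradiction p≤h (<⇒≱ h<p)

guessʳ+guessˡ : ∀ n p p' → p + p' ≡ n + 1 → guessʳ n p + guessˡ p' ≡ n + 1
guessʳ+guessˡ n p p' p+p' = begin
  n ∸ ⌊ (n + 1 ∸ p) /2⌋ + (⌊ p' /2⌋ + 1) ≡⟨ cong (λ x → n ∸ ⌊ x /2⌋ + (⌊ p' /2⌋ + 1)) n+1∸p≡p' ⟩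
  n ∸ ⌊ p' /2⌋ + (⌊ p' /2⌋ + 1)         ≡⟨ +-assoc (n ∸ ⌊ p' /2⌋) ⌊ p' /2⌋ 1 ⟨
  n ∸ ⌊ p' /2⌋ + ⌊ p' /2⌋ + 1           ≡⟨ cong (_+ 1) (m∸n+n≡m ⌊p'/2⌋≤n) ⟩
  n + 1                                 ∎
  where
  n+1∸p≡p' : n + 1 ∸ p ≡ p'
  n+1∸p≡p' = trans (cong (_∸ p) (sym p+p')) (m+n∸m≡n p p')
  p'≤1+n : p' ≤ suc n
  p'≤1+n = subst (p' ≤_) (trans p+p' (+-comm n 1)) (m≤n+m p' p)
  ⌊p'/2⌋≤n : ⌊ p' /2⌋ ≤ n
  ⌊p'/2⌋≤n = ≤-trans (⌊n/2⌋-mono p'≤1+n) (⌈n/2⌉≤n n)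

X-split : ∀ n u w → length u ≡ half n → length u + length w ≡ n →
  X n (u ++ mirror w) ≡ c (trues u + falses w + 1) u + c (trues w + falses u + 1) w
X-split n u w |u|≡h |u|+|w|≡n = begin
  matches (guess n) 1 1 (suc (trues (u ++ mirror w))) (u ++ mirror w)
    ≡⟨ cong (λ s → matches (guess n) 1 1 s (u ++ mirror w)) second-run-start ⟩
  matches (guess n) 1 1 s (u ++ mirror w)
    ≡⟨ matches-++ (guess n) 1 1 s u (mirror w) ⟩
  matches (guess n) 1 1 s u + matches (guess n) (suc (length u)) (suc t₁) (s + f₁) (mirror w)
    ≡⟨ cong₂ _+_ (matches-cong 1 1 s u left) (matches-cong (suc (length u)) (suc t₁) (s + f₁) (mirror w) right) ⟩
  c s u + matches (guessʳ n) (suc (length u)) (suc t₁) (s + f₁) (mirror w)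
    ≡⟨ cong (c s u +_) (matches-mirror (guessʳ n) guessˡ (guessʳ+guessˡ n) w
                          (cong (λ k → suc (k + 1)) |u|+|w|≡n) (by-counts (first-run-ends t₁ f₁ t₂ f₂))
                          (by-counts (second-run-ends t₁ f₁ t₂ f₂))) ⟩
  c s u + c (t₂ + f₁ + 1) w ∎
  where
  t₁ f₁ t₂ f₂ s : ℕ
  t₁ = trues u
  f₁ = falses u
  t₂ = trues w
  f₂ = falses w
  s = t₁ + f₂ + 1
  second-run-start : suc (trues (u ++ mirror w)) ≡ s
  second-run-start = trans (cong suc (trans (trues-++ u (mirror w)) (cong (t₁ +_) (trues-mirror w))))
                           (+-comm 1 (t₁ + f₂))
  left : ∀ {p} → 1 ≤ p → p < 1 + length u → guess n p ≡ guessˡ p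
  left {p} _ p<1+|u| = guess-≤-half n (subst (p ≤_) |u|≡h (≤-pred p<1+|u|))
  right : ∀ {p} → suc (length u) ≤ p → p < suc (length u) + length (mirror w) → guess n p ≡ guessʳ n p
  right {p} |u|<p _ = guess->-half n (subst (_< p) |u|≡h |u|<p)
  by-counts : ∀ {x} → x ≡ suc (t₁ + f₁ + (t₂ + f₂) + 1) → x ≡ suc (n + 1)
  by-counts x≡ = trans x≡ (cong (λ k → suc (k + 1))
    (trans (cong₂ _+_ (trues+falses≡length u) (trues+falses≡length w)) |u|+|w|≡n))
  first-run-ends : ∀ t₁ f₁ t₂ f₂ → suc t₁ + f₂ + (t₂ + f₁ + 1) ≡ suc (t₁ + f₁ + (t₂ + f₂) + 1)
  first-run-ends = solve-∀
  second-run-ends : ∀ t₁ f₁ t₂ f₂ → t₁ + f₂ + 1 + f₁ + t₂ + 1 ≡ suc (t₁ + f₁ + (t₂ + f₂) + 1)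
  second-run-ends = solve-∀

F-halves : ∀ n q → F n q ≡ sumWords (half n) (λ u → sumWords (n ∸ half n) (λ w →
  q ^ c (trues u + (n ∸ half n ∸ trues w) + 1) u * q ^ c (trues w + (half n ∸ trues u) + 1) w))
F-halves n q = begin
  sumWords n (λ S → q ^ X n S)
    ≡⟨ cong (λ k → sumWords k (λ S → q ^ X n S)) (sym h+m≡n) ⟩
  sumWords (h + m) (λ S → q ^ X n S)
    ≡⟨ sumWords-split h m (λ S → q ^ X n S) ⟩
  sumWords h (λ u → sumWords m (λ v → q ^ X n (u ++ v)))
    ≡⟨ sum-map-cong (λ u → sumWords-mirror m (λ v → q ^ X n (u ++ v))) (allWords h) ⟨
  sumWords h (λ u → sumWords m (λ w → q ^ X n (u ++ mirror w)))
    ≡⟨ sumWords-cong h (λ u |u| → sumWords-cong m (λ w |w| → term u w |u| |w|)) ⟩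
  sumWords h (λ u → sumWords m (λ w →
    q ^ c (trues u + (m ∸ trues w) + 1) u * q ^ c (trues w + (h ∸ trues u) + 1) w)) ∎
  where
  h m : ℕ
  h = half n
  m = n ∸ half n
  h+m≡n : h + m ≡ n
  h+m≡n = m+[n∸m]≡n (⌈n/2⌉≤n n)
  falses-of : ∀ {k} w → length w ≡ k → falses w ≡ k ∸ trues w
  falses-of w |w| = trans (falses≡length∸trues w) (cong (_∸ trues w) |w|)
  term : ∀ u w → length u ≡ h → length w ≡ m → q ^ X n (u ++ mirror w) ≡
    q ^ c (trues u + (m ∸ trues w) + 1) u * q ^ c (trues w + (h ∸ trues u) + 1) w
  term u w |u| |w| = begin
    q ^ X n (u ++ mirror w)
      ≡⟨ cong (q ^_) (X-split n u w |u| (trans (cong₂ _+_ |u| |w|) h+m≡n)) ⟩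
    q ^ (c (trues u + falses w + 1) u + c (trues w + falses u + 1) w)
      ≡⟨ ^-distribˡ-+-* q (c (trues u + falses w + 1) u) (c (trues w + falses u + 1) w) ⟩
    q ^ c (trues u + falses w + 1) u * q ^ c (trues w + falses u + 1) w
      ≡⟨ cong₂ (λ f₂ f₁ → q ^ c (trues u + f₂ + 1) u * q ^ c (trues w + f₁ + 1) w)
               (falses-of w |w|) (falses-of u |u|) ⟩
    q ^ c (trues u + (m ∸ trues w) + 1) u * q ^ c (trues w + (h ∸ trues u) + 1) w ∎

G≡sumWordsWithTrues : ∀ {a k} s q → a ≤ k → G a (k ∸ a) s q ≡ sumWordsWithTrues k a (λ w → q ^ c s w)
G≡sumWordsWithTrues {a} s q a≤k =
  cong (λ k → sum (map (λ w → q ^ c s w) (filter (λ w → trues w ≟ a) (allWords k)))) (m+[n∸m]≡n a≤k)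

Σ-sumWordsWithTrues : ∀ k (f : ℕ → List Bool → ℕ) →
  Σ[0… k ] (λ a → sumWordsWithTrues k a (f a)) ≡ sumWords k (λ w → f (trues w) w)
Σ-sumWordsWithTrues k f = Σ-fibres k trues f (allWords-trues≤ k)

Σ-sumWordsWithTrues-* : ∀ h m (f g : ℕ → ℕ → List Bool → ℕ) →
  Σ[0… h ] (λ a → Σ[0… m ] (λ b → sumWordsWithTrues h a (f a b) * sumWordsWithTrues m b (g a b)))
  ≡ sumWords h (λ u → sumWords m (λ w → f (trues u) (trues w) u * g (trues u) (trues w) w))
Σ-sumWordsWithTrues-* h m f g = begin
  Σ[0… h ] (λ a → Σ[0… m ] (λ b → sumWordsWithTrues h a (f a b) * sumWordsWithTrues m b (g a b)))
    ≡⟨ sum-map-cong (λ a → sum-map-cong (λ b → sum-map-* (f a b) (g a b) (fibre h a) (fibre m b)) (upTo (suc m)))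
                    (upTo (suc h)) ⟩
  Σ[0… h ] (λ a → Σ[0… m ] (λ b → sumWordsWithTrues h a (λ u → sumWordsWithTrues m b (term a b u))))
    ≡⟨ sum-map-cong (λ a → sum-map-swap (λ b u → sumWordsWithTrues m b (term a b u)) (upTo (suc m)) (fibre h a))
                    (upTo (suc h)) ⟩
  Σ[0… h ] (λ a → sumWordsWithTrues h a (λ u → Σ[0… m ] (λ b → sumWordsWithTrues m b (term a b u))))
    ≡⟨ sum-map-cong (λ a → sum-map-cong (λ u → Σ-sumWordsWithTrues m (λ b → term a b u)) (fibre h a))
                    (upTo (suc h)) ⟩
  Σ[0… h ] (λ a → sumWordsWithTrues h a (λ u → sumWords m (λ w → term a (trues w) u w)))
    ≡⟨ Σ-sumWordsWithTrues h (λ a u → sumWords m (λ w → term a (trues w) u w)) ⟩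
  sumWords h (λ u → sumWords m (λ w → term (trues u) (trues w) u w)) ∎
  where
  fibre : ℕ → ℕ → List (List Bool)
  fibre k a = filter (λ w → trues w ≟ a) (allWords k)
  term : ℕ → ℕ → List Bool → List Bool → ℕ
  term a b u w = f a b u * g a b w

corollary1 : (n : ℕ) → n ≥ 1 → (q : ℕ) →
    F n q ≡ Σ[0… half n ] (λ a → Σ[0… n ∸ half n ] (λ b →
      G a (half n ∸ a) (a + (n ∸ half n ∸ b) + 1) q
        * G b (n ∸ half n ∸ b) (b + (half n ∸ a) + 1) q))
corollary1 n _ q = begin
  F n q
    ≡⟨ F-halves n q ⟩
  sumWords h (λ u → sumWords m (λ w → left (trues u) (trues w) u * right (trues u) (trues w) w))
    ≡⟨ Σ-sumWordsWithTrues-* h m left right ⟨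
  Σ[0… h ] (λ a → Σ[0… m ] (λ b → sumWordsWithTrues h a (left a b) * sumWordsWithTrues m b (right a b)))
    ≡⟨ Σ-cong h (λ a≤h → Σ-cong m (λ b≤m →
         cong₂ _*_ (G≡sumWordsWithTrues _ q a≤h) (G≡sumWordsWithTrues _ q b≤m))) ⟨
  Σ[0… h ] (λ a → Σ[0… m ] (λ b → G a (h ∸ a) (a + (m ∸ b) + 1) q * G b (m ∸ b) (b + (h ∸ a) + 1) q)) ∎
  where
  h m : ℕ
  h = half n
  m = n ∸ half n
  left right : ℕ → ℕ → List Bool → ℕ
  left  a b u = q ^ c (a + (m ∸ b) + 1) u
  right a b w = q ^ c (b + (h ∸ a) + 1) w
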